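{- Let $P$ be a finite poset, $\mathbb{S}$ a skew field containing an infinite field as a subfield, $C$ a central element of $\mathbb{S}$, and $u,v\in P$ incomparable. Then the noncommutative antichain toggles and elggots satisfy $\tau_u\tau_v=\tau_v\tau_u$, $\varepsilon_u\varepsilon_v=\varepsilon_v\varepsilon_u$, and $\tau_u\varepsilon_v=\varepsilon_v\tau_u$ (as partial maps, where defined).
   Context: $\mathbb{S}^P$ is the set of labelings $g:P\to\mathbb{S}$; products denote composition; $\overline{x}=x^{ -1}$. For $v\in P$, the noncommutative antichain toggle $\tau_v$ changes only the label at $v$: $(\tau_vg)(v)=C\cdot\overline{\sum g(y_{c-1})\cdots g(y_1)\,g(y_k)\cdots g(y_c)}$, and the elggot $\varepsilon_v$ changes only the label at $v$: $(\varepsilon_vg)(v)=C\cdot\overline{\sum g(y_c)\cdots g(y_1)\,g(y_k)\cdots g(y_{c+1})}$; both sums range over all maximal chains $y_1\lessdot y_2\lessdot\cdots\lessdot y_k$ of $P$ with $y_c=v$ (in each product the indices decrease by one within each of the two blocks). -}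

module Defs where

open import Level using (Level; _⊔_; suc)
open import Data.Nat using (ℕ)
open import Data.Fin using (Fin)
open import Data.Fin.Properties using (all?; any?)
open import Data.Bool using (Bool; true; false; if_then_else_)
open import Data.List using (List; []; _∷_; _++_; [_]; reverse; map; concatMap; filter; upTo; foldr)
open import Data.Maybe using (Maybe; just; nothing)
open import Data.Product using (Σ; _×_; _,_; proj₁; proj₂)
open import Data.Empty using (⊥)
open import Data.Unit using (⊤)
open import Relation.Nullary using (¬_; Dec; yes; no; ¬?)
open import Relation.Nullary.Decidable using (_×-dec_; ⌊_⌋)
open import Relation.Binary.PropositionalEquality using (_≡_; _≢_)
open import Relation.Binary.Structures using (IsDecPartialOrder)
open import Algebra.Bundles using (Ring)

record SkewField (c ℓ : Level) : Set (suc (c ⊔ ℓ)) where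
  field
    ring : Ring c ℓ
  open Ring ring public
  field
    _⁻¹      : (x : Carrier) → ¬ (x ≈ 0#) → Carrier
    inverseʳ : (x : Carrier) (p : ¬ (x ≈ 0#)) → x * (x ⁻¹) p ≈ 1#
    inverseˡ : (x : Carrier) (p : ¬ (x ≈ 0#)) → (x ⁻¹) p * x ≈ 1#
    1≉0      : ¬ (1# ≈ 0#)

module _ {c ℓ : Level} (S : SkewField c ℓ) where
  open SkewField S

  Central : Carrier → Set (c ⊔ ℓ)
  Central z = ∀ x → z * x ≈ x * z

  record IsSubfield {k : Level} (K : Carrier → Set k) : Set (c ⊔ ℓ ⊔ k) where
    field
      K-resp-≈ : ∀ {x y} → x ≈ y → K x → K y
      K-0      : K 0#
      K-1      : K 1#
      K-+      : ∀ {x y} → K x → K y → K (x + y)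
      K--      : ∀ {x} → K x → K (- x)
      K-*      : ∀ {x y} → K x → K y → K (x * y)
      K-⁻¹     : ∀ {x} (p : ¬ (x ≈ 0#)) → K x → K ((x ⁻¹) p)
      K-comm   : ∀ {x y} → K x → K y → x * y ≈ y * x

  IsInfinite : {k : Level} → (Carrier → Set k) → Set (c ⊔ ℓ ⊔ k)
  IsInfinite K = Σ (ℕ → Carrier) λ f →
    (∀ i → K (f i)) × (∀ i j → f i ≈ f j → i ≡ j)

  HasInfiniteSubfield : (k : Level) → Set (c ⊔ ℓ ⊔ Level.suc k)
  HasInfiniteSubfield k =
    Σ (Carrier → Set k) λ K → IsSubfield K × IsInfinite K

record FinPoset : Set₁ where
  field
    size  : ℕ
    _≤_   : Fin size → Fin size → Set
    isDecPartialOrder : IsDecPartialOrder _≡_ _≤_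
  open IsDecPartialOrder isDecPartialOrder public using (_≟_; _≤?_)

module Chains (P : FinPoset) where
  open FinPoset P

  Elt : Set
  Elt = Fin size

  _<_ : Elt → Elt → Set
  x < y = x ≤ y × x ≢ y

  _<?_ : ∀ x y → Dec (x < y)
  x <? y = (x ≤? y) ×-dec ¬? (x ≟ y)

  _⋖_ : Elt → Elt → Set
  x ⋖ y = x < y × (∀ z → ¬ (x < z × z < y))

  _⋖?_ : ∀ x y → Dec (x ⋖ y)
  x ⋖? y = (x <? y) ×-dec all? (λ z → ¬? ((x <? z) ×-dec (z <? y)))

  isMinimal? : Elt → Bool
  isMinimal? x = ⌊ all? (λ z → ¬? (z <? x)) ⌋

  isMaximal? : Elt → Bool
  isMaximal? x = ⌊ all? (λ z → ¬? (x <? z)) ⌋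

  chainFrom? : Elt → List Elt → Bool
  chainFrom? x []       = isMaximal? x
  chainFrom? x (y ∷ ys) = if ⌊ x ⋖? y ⌋ then chainFrom? y ys else false

  isMaxChain? : List Elt → Bool
  isMaxChain? []       = false
  isMaxChain? (x ∷ ys) = if isMinimal? x then chainFrom? x ys else false

  allFins : List Elt
  allFins = Data.List.allFin size
    where import Data.List

  listsOfLength : ℕ → List (List Elt)
  listsOfLength ℕ.zero    = [] ∷ []
  listsOfLength (ℕ.suc k) =
    concatMap (λ x → map (x ∷_) (listsOfLength k)) allFins

  -- the list of all maximal chains of P (each exactly once; a chain has
  -- distinct elements, hence length ≤ size)
  maximalChains : List (List Elt)
  maximalChains =
    filter (λ ys → isMaxChain? ys Data.Bool.≟ true)
           (concatMap listsOfLength (upTo (ℕ.suc size)))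
    where import Data.Bool

  splitAt : Elt → List Elt → Maybe (List Elt × List Elt)
  splitAt v []       = nothing
  splitAt v (y ∷ ys) with y ≟ v
  ... | yes _ = just ([] , ys)
  ... | no  _ with splitAt v ys
  ...   | nothing          = nothing
  ...   | just (pre , post) = just (y ∷ pre , post)

record PartialMap {a} (A : Set a) (d : Level) : Set (a ⊔ Level.suc d) where
  field
    Dom : A → Set d
    app : (x : A) → Dom x → A

_∘ₚ_ : ∀ {a d} {A : Set a} → PartialMap A d → PartialMap A d → PartialMap A d
f ∘ₚ g = record
  { Dom = λ x → Σ (PartialMap.Dom g x) λ p → PartialMap.Dom f (PartialMap.app g x p)
  ; app = λ x pq → PartialMap.app f (PartialMap.app g x (proj₁ pq)) (proj₂ pq)
  }

PartialEq : ∀ {a d r} {A : Set a} → (A → A → Set r) →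
            PartialMap A d → PartialMap A d → Set (a ⊔ d ⊔ r)
PartialEq _≈_ f g =
  (∀ x → PartialMap.Dom f x → PartialMap.Dom g x) ×
  (∀ x → PartialMap.Dom g x → PartialMap.Dom f x) ×
  (∀ x p q → PartialMap.app f x p ≈ PartialMap.app g x q)

module Toggles {c ℓ : Level} (S : SkewField c ℓ) (P : FinPoset) (C : SkewField.Carrier S) where
  open SkewField S
  open FinPoset P using (size; _≟_)
  open Chains P

  Labeling : Set c
  Labeling = Elt → Carrier

  _≈ₗ_ : Labeling → Labeling → Set ℓ
  f ≈ₗ g = ∀ x → f x ≈ g x

  prodL : Labeling → List Elt → Carrier
  prodL g = foldr (λ y r → g y * r) 1#

  -- the term g(y_{c-1})⋯g(y_1) g(y_k)⋯g(y_c) for a chain pre ++ [v] ++ post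
  toggleTerm : Labeling → Elt → List Elt → Carrier
  toggleTerm g v ys with splitAt v ys
  ... | nothing          = 0#
  ... | just (pre , post) = prodL g (reverse pre) * prodL g (reverse (v ∷ post))

  -- the term g(y_c)⋯g(y_1) g(y_k)⋯g(y_{c+1})
  elggotTerm : Labeling → Elt → List Elt → Carrier
  elggotTerm g v ys with splitAt v ys
  ... | nothing          = 0#
  ... | just (pre , post) = prodL g (reverse (pre ++ [ v ])) * prodL g (reverse post)

  -- chains not containing v contribute 0, i.e. the sums range over the
  -- maximal chains with y_c = v
  sumS : List Carrier → Carrier
  sumS = foldr _+_ 0#

  toggleSum : Labeling → Elt → Carrier
  toggleSum g v = sumS (map (toggleTerm g v) maximalChains)

  elggotSum : Labeling → Elt → Carrier
  elggotSum g v = sumS (map (elggotTerm g v) maximalChains)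

  update : Labeling → Elt → Carrier → Labeling
  update g v a x with x ≟ v
  ... | yes _ = a
  ... | no  _ = g x

  τ : Elt → PartialMap Labeling ℓ
  τ v = record
    { Dom = λ g → ¬ (toggleSum g v ≈ 0#)
    ; app = λ g p → update g v (C * (toggleSum g v ⁻¹) p)
    }

  ε : Elt → PartialMap Labeling ℓ
  ε v = record
    { Dom = λ g → ¬ (elggotSum g v ≈ 0#)
    ; app = λ g p → update g v (C * (elggotSum g v ⁻¹) p)
    }

  _≈ₚ_ : PartialMap Labeling ℓ → PartialMap Labeling ℓ → Set (c ⊔ ℓ)
  _≈ₚ_ = PartialEq _≈ₗ_

module Submission where

-- Incomparable elements u, v of a finite poset never lie on a common
-- maximal chain.  Hence the sum defining τ_u or ε_u only involves labels
-- of elements comparable with u, and does not see the label at v (and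
-- symmetrically).  Commutation is then an instance of a general fact:
-- two partial maps that reset the labels at distinct points u ≠ v to
-- C·F(g)⁻¹ and C·G(g)⁻¹, where F ignores the label at v and G ignores the
-- label at u, commute as partial maps (same domains, equal values).

open import Defs
open import Level using (Level; _⊔_)
open import Data.Product using (_×_; _,_)
open import Data.Sum using (_⊎_; inj₁; inj₂)
open import Data.Nat as ℕ using ()
open import Data.Bool as Bool using (true; false)
open import Data.Maybe using (just; nothing)
open import Data.List as List using (List; []; _∷_; _++_; [_]; reverse; map)
open import Data.List.Relation.Unary.Any using (here; there)
open import Data.List.Relation.Unary.All as All using (All; []; _∷_)
open import Data.List.Relation.Unary.All.Properties using (all-filter)
open import Data.List.Relation.Unary.Any.Properties using (reverse⁻)
open import Data.List.Membership.Propositional using (_∈_; _∉_)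
open import Data.List.Relation.Binary.Subset.Propositional using (_⊆_)
open import Data.List.Relation.Binary.Subset.Propositional.Properties
  using (xs⊆xs++ys; xs⊆ys++xs; xs⊆x∷xs; ++⁺ʳ)
open import Relation.Nullary using (¬_; Dec; yes; no; contradiction)
open import Relation.Binary.PropositionalEquality using (_≡_; _≢_; refl; cong)
open import Relation.Binary.Structures using (IsDecPartialOrder)

module Commutation {c ℓ : Level} (S : SkewField c ℓ) (P : FinPoset)
                   (C : SkewField.Carrier S) where
  open SkewField S renaming (refl to ≈-refl; sym to ≈-sym; trans to ≈-trans)
  open FinPoset P using (size; _≤_; _≟_; isDecPartialOrder)
  open IsDecPartialOrder isDecPartialOrder using ()
    renaming (refl to ≤-refl; trans to ≤-trans)
  open Chains P
  open Toggles S P C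
  open import Relation.Binary.Reasoning.Setoid setoid

  ⁻¹-cong : ∀ {x y} (p : ¬ (x ≈ 0#)) (q : ¬ (y ≈ 0#)) → x ≈ y → (x ⁻¹) p ≈ (y ⁻¹) q
  ⁻¹-cong {x} {y} p q x≈y = begin
    (x ⁻¹) p                  ≈⟨ ≈-sym (*-identityʳ _) ⟩
    (x ⁻¹) p * 1#             ≈⟨ *-cong ≈-refl (≈-sym (inverseʳ y q)) ⟩
    (x ⁻¹) p * (y * (y ⁻¹) q) ≈⟨ *-cong ≈-refl (*-cong (≈-sym x≈y) ≈-refl) ⟩
    (x ⁻¹) p * (x * (y ⁻¹) q) ≈⟨ ≈-sym (*-assoc _ _ _) ⟩
    ((x ⁻¹) p * x) * (y ⁻¹) q ≈⟨ *-cong (inverseˡ x p) ≈-refl ⟩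
    1# * (y ⁻¹) q             ≈⟨ *-identityˡ _ ⟩
    (y ⁻¹) q                  ∎

  update-at : ∀ g {v} a {x} → x ≡ v → update g v a x ≡ a
  update-at g {v} a {x} x≡v with x ≟ v
  ... | yes _   = refl
  ... | no x≢v = contradiction x≡v x≢v

  update-off : ∀ g {v} a {x} → x ≢ v → update g v a x ≡ g x
  update-off g {v} a {x} x≢v with x ≟ v
  ... | yes x≡v = contradiction x≡v x≢v
  ... | no _    = refl

  update-swap : ∀ g {u v} → u ≢ v → ∀ {a a′ b b′} → a ≈ a′ → b ≈ b′ →
                update (update g v b) u a ≈ₗ update (update g u a′) v b′
  update-swap g {u} {v} u≢v {a} {a′} {b} {b′} a≈a′ b≈b′ x = cases (x ≟ u) (x ≟ v)
    where
    -- split on the positions without abstracting the ≟ tests inside update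
    cases : Dec (x ≡ u) → Dec (x ≡ v) →
            update (update g v b) u a x ≈ update (update g u a′) v b′ x
    cases (yes refl) (yes refl) = contradiction refl u≢v
    cases (yes x≡u)  (no x≢v)   = begin
      update (update g v b) u a x   ≡⟨ update-at _ a x≡u ⟩
      a                             ≈⟨ a≈a′ ⟩
      a′                            ≡⟨ update-at g a′ x≡u ⟨
      update g u a′ x               ≡⟨ update-off _ b′ x≢v ⟨
      update (update g u a′) v b′ x ∎
    cases (no x≢u)   (yes x≡v)  = begin
      update (update g v b) u a x   ≡⟨ update-off _ a x≢u ⟩
      update g v b x                ≡⟨ update-at g b x≡v ⟩
      b                             ≈⟨ b≈b′ ⟩
      b′                            ≡⟨ update-at _ b′ x≡v ⟨
      update (update g u a′) v b′ x ∎
    cases (no x≢u)   (no x≢v)   = begin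
      update (update g v b) u a x   ≡⟨ update-off _ a x≢u ⟩
      update g v b x                ≡⟨ update-off g b x≢v ⟩
      g x                           ≡⟨ update-off g a′ x≢u ⟨
      update g u a′ x               ≡⟨ update-off _ b′ x≢v ⟨
      update (update g u a′) v b′ x ∎

  AgreeOn : Labeling → Labeling → List Elt → Set ℓ
  AgreeOn g h xs = ∀ {x} → x ∈ xs → g x ≈ h x

  update-elsewhere : ∀ g {z} a {xs} → z ∉ xs → AgreeOn (update g z a) g xs
  update-elsewhere g {z} a z∉xs {x} x∈xs with x ≟ z
  ... | yes refl = contradiction x∈xs z∉xs
  ... | no _     = ≈-refl

  Ignores : Elt → (Labeling → Carrier) → Set (c ⊔ ℓ)
  Ignores v F = ∀ g a → F (update g v a) ≈ F g

  -- The partial map replacing the label at v by C·F(g)⁻¹, defined where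
  -- F(g) ≉ 0.  Both τ v and ε v are of this form, definitionally.
  reset : Elt → (Labeling → Carrier) → PartialMap Labeling ℓ
  reset v F = record
    { Dom = λ g → ¬ (F g ≈ 0#)
    ; app = λ g p → update g v (C * (F g ⁻¹) p)
    }

  reset-comm : ∀ {u v} (F G : Labeling → Carrier) → u ≢ v →
               Ignores v F → Ignores u G →
               (reset u F ∘ₚ reset v G) ≈ₚ (reset v G ∘ₚ reset u F)
  reset-comm {u} {v} F G u≢v F-ign G-ign = dom⇒ , dom⇐ , values
    where
      dom⇒ : ∀ g → PartialMap.Dom (reset u F ∘ₚ reset v G) g →
                   PartialMap.Dom (reset v G ∘ₚ reset u F) g
      dom⇒ g (Gg≉0 , F′g≉0) =
        (λ Fg≈0 → F′g≉0 (≈-trans (F-ign g _) Fg≈0)) ,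
        (λ G′g≈0 → Gg≉0 (≈-trans (≈-sym (G-ign g _)) G′g≈0))

      dom⇐ : ∀ g → PartialMap.Dom (reset v G ∘ₚ reset u F) g →
                   PartialMap.Dom (reset u F ∘ₚ reset v G) g
      dom⇐ g (Fg≉0 , G′g≉0) =
        (λ Gg≈0 → G′g≉0 (≈-trans (G-ign g _) Gg≈0)) ,
        (λ F′g≈0 → Fg≉0 (≈-trans (≈-sym (F-ign g _)) F′g≈0))

      values : ∀ g p q →
               PartialMap.app (reset u F ∘ₚ reset v G) g p ≈ₗ
               PartialMap.app (reset v G ∘ₚ reset u F) g q
      values g (Gg≉0 , F′g≉0) (Fg≉0 , G′g≉0) =
        update-swap g u≢v
          (*-cong ≈-refl (⁻¹-cong F′g≉0 Fg≉0 (F-ign g _)))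
          (*-cong ≈-refl (⁻¹-cong Gg≉0 G′g≉0 (≈-sym (G-ign g _))))

  Comparable : Elt → Elt → Set
  Comparable a b = a ≤ b ⊎ b ≤ a

  chainFrom-above : ∀ x ys → chainFrom? x ys ≡ true → All (x ≤_) (x ∷ ys)
  chainFrom-above x []       _ = ≤-refl ∷ []
  chainFrom-above x (y ∷ ys) h with x ⋖? y
  ... | yes ((x≤y , _) , _) =
          ≤-refl ∷ All.map (≤-trans x≤y) (chainFrom-above y ys h)
  ... | no _ with () ← h

  chainFrom-comparable : ∀ x ys → chainFrom? x ys ≡ true →
                         ∀ {a b} → a ∈ x ∷ ys → b ∈ x ∷ ys → Comparable a b
  chainFrom-comparable x ys h (here refl) b∈ = inj₁ (All.lookup (chainFrom-above x ys h) b∈)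
  chainFrom-comparable x ys h (there a∈) (here refl) =
    inj₂ (All.lookup (chainFrom-above x ys h) (there a∈))
  chainFrom-comparable x (y ∷ ys) h (there a∈) (there b∈) with x ⋖? y
  ... | yes _ = chainFrom-comparable y ys h a∈ b∈
  ... | no _ with () ← h

  maxChain-comparable : ∀ ys → isMaxChain? ys ≡ true →
                        ∀ {a b} → a ∈ ys → b ∈ ys → Comparable a b
  maxChain-comparable (x ∷ ys) h with isMinimal? x
  ... | true = chainFrom-comparable x ys h
  ... | false with () ← h

  maximalChains-valid : All (λ ys → isMaxChain? ys ≡ true) maximalChains
  maximalChains-valid =
    all-filter (λ ys → isMaxChain? ys Bool.≟ true)
               (List.concatMap listsOfLength (List.upTo (ℕ.suc size)))

  maxChain-avoids : ∀ {w z} → ¬ (w ≤ z) → ¬ (z ≤ w) → ∀ ys →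
                    isMaxChain? ys ≡ true → w ∈ ys → z ∉ ys
  maxChain-avoids w≰z z≰w ys h w∈ z∈ with maxChain-comparable ys h w∈ z∈
  ... | inj₁ w≤z = w≰z w≤z
  ... | inj₂ z≤w = z≰w z≤w

  prodL-local : ∀ {g h xs ys} → xs ⊆ ys → AgreeOn g h ys → prodL g xs ≈ prodL h xs
  prodL-local {xs = []}     _  _  = ≈-refl
  prodL-local {xs = x ∷ xs} xs⊆ agree =
    *-cong (agree (xs⊆ (here refl))) (prodL-local (λ m → xs⊆ (there m)) agree)

  reverse-⊆ : ∀ {xs ys : List Elt} → xs ⊆ ys → reverse xs ⊆ ys
  reverse-⊆ xs⊆ m = xs⊆ (reverse⁻ m)

  splitAt-correct : ∀ v ys {pre post} → splitAt v ys ≡ just (pre , post) →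
                    ys ≡ pre ++ v ∷ post
  splitAt-correct v []       ()
  splitAt-correct v (y ∷ ys) e with y ≟ v
  splitAt-correct v (y ∷ ys) refl | yes refl = refl
  ... | no _ with splitAt v ys in e′
  splitAt-correct v (y ∷ ys) refl | no _ | just _ = cong (y ∷_) (splitAt-correct v ys e′)

  splitAt-agree : ∀ {g h} v ys {pre post} → splitAt v ys ≡ just (pre , post) →
                  (v ∈ ys → AgreeOn g h ys) → AgreeOn g h (pre ++ v ∷ post)
  splitAt-agree v ys {pre} e agree with refl ← splitAt-correct v ys e =
    agree (xs⊆ys++xs _ pre (here refl))

  toggleTerm-local : ∀ g h v ys → (v ∈ ys → AgreeOn g h ys) →
                     toggleTerm g v ys ≈ toggleTerm h v ys
  toggleTerm-local g h v ys agree with splitAt v ys in e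
  ... | nothing          = ≈-refl
  ... | just (pre , post) =
    *-cong (prodL-local (reverse-⊆ (xs⊆xs++ys pre _)) chain)
           (prodL-local (reverse-⊆ (xs⊆ys++xs (v ∷ post) pre)) chain)
    where chain = splitAt-agree v ys e agree

  elggotTerm-local : ∀ g h v ys → (v ∈ ys → AgreeOn g h ys) →
                     elggotTerm g v ys ≈ elggotTerm h v ys
  elggotTerm-local g h v ys agree with splitAt v ys in e
  ... | nothing          = ≈-refl
  ... | just (pre , post) =
    *-cong (prodL-local (reverse-⊆ (++⁺ʳ pre (xs⊆xs++ys [ v ] post))) chain)
           (prodL-local (reverse-⊆ (λ m → xs⊆ys++xs (v ∷ post) pre (xs⊆x∷xs post v m))) chain)
    where chain = splitAt-agree v ys e agree

  sumS-cong : ∀ {A : Set} (T₁ T₂ : A → Carrier) xs → All (λ x → T₁ x ≈ T₂ x) xs →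
              sumS (map T₁ xs) ≈ sumS (map T₂ xs)
  sumS-cong T₁ T₂ []       []       = ≈-refl
  sumS-cong T₁ T₂ (x ∷ xs) (e ∷ es) = +-cong e (sumS-cong T₁ T₂ xs es)

  chain-unaffected : ∀ {w z} → ¬ (w ≤ z) → ¬ (z ≤ w) → ∀ g a ys →
                     isMaxChain? ys ≡ true → w ∈ ys → AgreeOn (update g z a) g ys
  chain-unaffected w≰z z≰w g a ys h w∈ =
    update-elsewhere g a (maxChain-avoids w≰z z≰w ys h w∈)

  toggleSum-ignores : ∀ {w z} → ¬ (w ≤ z) → ¬ (z ≤ w) → Ignores z (λ g → toggleSum g w)
  toggleSum-ignores {w} w≰z z≰w g a = sumS-cong _ _ maximalChains
    (All.map (λ {ys} h → toggleTerm-local _ _ w ys (chain-unaffected w≰z z≰w g a ys h))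
             maximalChains-valid)

  elggotSum-ignores : ∀ {w z} → ¬ (w ≤ z) → ¬ (z ≤ w) → Ignores z (λ g → elggotSum g w)
  elggotSum-ignores {w} w≰z z≰w g a = sumS-cong _ _ maximalChains
    (All.map (λ {ys} h → elggotTerm-local _ _ w ys (chain-unaffected w≰z z≰w g a ys h))
             maximalChains-valid)

proposition5p14 : {c ℓ k : Level} (P : FinPoset) (S : SkewField c ℓ) →
    HasInfiniteSubfield S k →
    (C : SkewField.Carrier S) → Central S C →
    (u v : Chains.Elt P) →
    ¬ (FinPoset._≤_ P u v) → ¬ (FinPoset._≤_ P v u) →
    let open Toggles S P C in
    ((τ u ∘ₚ τ v) ≈ₚ (τ v ∘ₚ τ u)) ×
    ((ε u ∘ₚ ε v) ≈ₚ (ε v ∘ₚ ε u)) ×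
    ((τ u ∘ₚ ε v) ≈ₚ (ε v ∘ₚ τ u))
proposition5p14 P S _ C _ u v u≰v v≰u =
    reset-comm togU togV u≢v (toggleSum-ignores u≰v v≰u) (toggleSum-ignores v≰u u≰v) ,
    reset-comm elgU elgV u≢v (elggotSum-ignores u≰v v≰u) (elggotSum-ignores v≰u u≰v) ,
    reset-comm togU elgV u≢v (toggleSum-ignores u≰v v≰u) (elggotSum-ignores v≰u u≰v)
  where
    open Commutation S P C
    open Toggles S P C
    togU togV elgU elgV : Labeling → SkewField.Carrier S
    togU = λ g → toggleSum g u
    togV = λ g → toggleSum g v
    elgU = λ g → elggotSum g u
    elgV = λ g → elggotSum g v

    u≢v : u ≢ v
    u≢v refl = u≰v (IsDecPartialOrder.refl (FinPoset.isDecPartialOrder P))
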